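{- Let $n\ge 2$ and let $G$ be a labeled threshold graph on vertex set $[n]$. Then all constructions of $G$ that follow the convention about the vertex $1$ have the same number of odd anchors.
   Context: A signed permutation of $[n]$ is a permutation $\pi_1\cdots\pi_n$ of $[n]$ with a sign $w_i\in\{+,-\}$ assigned to each $\pi_i$. The construction associated to a signed permutation builds a graph on $[n]$ starting from the empty graph by adding the vertices $\pi_1,\pi_2,\dots,\pi_n$ in this order, where $\pi_i$ is added as a dominant vertex (adjacent to all previously added vertices) if $w_i=+$ and as a recessive vertex (adjacent to no previously added vertex) if $w_i=-$. A labeled threshold graph on $[n]$ is a graph obtained this way; a construction of $G$ is a signed permutation whose associated construction yields $G$. A threshold pair in standard form is a signed permutation with $w_1=w_2$ and such that $w_i=w_{i+1}$ implies $\pi_i<\pi_{i+1}$; every labeled threshold graph $G$ has exactly one construction which is a threshold pair in standard form, and the blocks of $G$ are the maximal runs of consecutive entries with equal sign in it, ordered left to right (the first block thus has size at least $2$). Convention about vertex $1$: a construction of $G$ follows the convention if, whenever $1$ belongs to the first block of $G$, the construction adds $1$ as the first vertex and with sign $+$ (i.e., $1$ is regarded as dominant). In a construction, an anchor is a vertex whose label is smaller than the labels of all vertices added after it (so the first anchor is always $1$); the type of a vertex is dominant or recessive according to its sign. An odd anchor is an anchor that is either the first anchor $1$ and dominant, or an anchor whose type differs from that of the previous anchor. -}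

module Defs where

open import Data.Nat using (ℕ; zero; suc; _+_)
open import Data.Bool using (Bool; true; false; if_then_else_; not; _∧_)
open import Data.Fin using (Fin; toℕ; _<_; _<?_; _≟_)
open import Data.List using (List; []; _∷_; map; allFin)
open import Data.List.Relation.Binary.Permutation.Propositional using (_↭_)
open import Data.List.Relation.Unary.Any using (Any)
open import Data.Product using (_×_; _,_; proj₁; proj₂; Σ; ∃)
open import Data.Unit using (⊤)
open import Data.Empty using (⊥)
open import Relation.Nullary.Decidable using (⌊_⌋)
open import Relation.Binary.PropositionalEquality using (_≡_)
open import Data.Bool.Properties using () renaming (_≟_ to _≟B_)

-- Vertex labels: Fin n, where the label k : Fin n stands for the vertex (toℕ k + 1) ∈ [n].
-- Signs / types: true = "+" (dominant), false = "-" (recessive).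

Entry : ℕ → Set
Entry n = Fin n × Bool

record SignedPerm (n : ℕ) : Set where
  constructor mkSP
  field
    entries : List (Entry n)
    isPerm  : map proj₁ entries ↭ allFin n
open SignedPerm public

Graph : ℕ → Set
Graph n = Fin n → Fin n → Bool

-- Sign of w among the entries (false if w does not occur).
laterSign : ∀ {n} → List (Entry n) → Fin n → Bool
laterSign [] w = false
laterSign ((x , s) ∷ r) w = if ⌊ x ≟ w ⌋ then s else laterSign r w

-- Adjacency in the graph built by the construction: vertices are added in list
-- order; when the later of u, v is added it is joined to the earlier one iff
-- it is dominant.
adjL : ∀ {n} → List (Entry n) → Fin n → Fin n → Bool
adjL [] u v = false
adjL ((x , s) ∷ r) u v =
  if ⌊ x ≟ u ⌋ then laterSign r v
  else if ⌊ x ≟ v ⌋ then laterSign r u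
  else adjL r u v

graphOf : ∀ {n} → SignedPerm n → Graph n
graphOf c = adjL (entries c)

IsConstructionOf : ∀ {n} → SignedPerm n → Graph n → Set
IsConstructionOf c G = ∀ u v → graphOf c u v ≡ G u v

IsLabeledThreshold : ∀ {n} → Graph n → Set
IsLabeledThreshold {n} G = ∃ λ (c : SignedPerm n) → IsConstructionOf c G

SameSignIncr : ∀ {n} → List (Entry n) → Set
SameSignIncr [] = ⊤
SameSignIncr (a ∷ []) = ⊤
SameSignIncr (a ∷ b ∷ r) = (proj₂ a ≡ proj₂ b → proj₁ a < proj₁ b) × SameSignIncr (b ∷ r)

IsStandardForm : ∀ {n} → List (Entry n) → Set
IsStandardForm [] = ⊥
IsStandardForm (a ∷ []) = ⊥
IsStandardForm (a ∷ b ∷ r) = (proj₂ a ≡ proj₂ b) × SameSignIncr (a ∷ b ∷ r)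

runWith : ∀ {n} → Bool → List (Entry n) → List (Fin n)
runWith s [] = []
runWith s ((y , t) ∷ r) = if ⌊ t ≟B s ⌋ then y ∷ runWith s r else []

firstBlock : ∀ {n} → List (Entry n) → List (Fin n)
firstBlock [] = []
firstBlock ((x , s) ∷ r) = x ∷ runWith s r

IsVertexOne : ∀ {n} → Fin n → Set
IsVertexOne x = toℕ x ≡ 0

-- Vertex 1 belongs to the first block of G (first block read off the
-- standard-form construction of G).
OneInFirstBlock : ∀ {n} → Graph n → Set
OneInFirstBlock {n} G =
  ∃ λ (s : SignedPerm n) → IsConstructionOf s G × IsStandardForm (entries s)
    × Any IsVertexOne (firstBlock (entries s))

FollowsConvention : ∀ {n} → SignedPerm n → Graph n → Set
FollowsConvention {n} c G =
  OneInFirstBlock G →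
  Σ (Fin n) λ x → Σ (List (Entry n)) λ rest →
    IsVertexOne x × entries c ≡ (x , true) ∷ rest

smallerThanAll : ∀ {n} → Fin n → List (Entry n) → Bool
smallerThanAll x [] = true
smallerThanAll x ((y , _) ∷ r) = ⌊ x <? y ⌋ ∧ smallerThanAll x r

anchors : ∀ {n} → List (Entry n) → List (Entry n)
anchors [] = []
anchors ((x , s) ∷ r) =
  if smallerThanAll x r then (x , s) ∷ anchors r else anchors r

changes : Bool → List Bool → ℕ
changes p [] = 0
changes p (s ∷ ss) = (if ⌊ s ≟B p ⌋ then 0 else 1) + changes s ss

-- Number of odd anchors given the list of anchor types in order:
-- the first anchor counts iff dominant, each later anchor counts iff its type
-- differs from that of the previous anchor.
countOdd : List Bool → ℕ
countOdd [] = 0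
countOdd (s ∷ ss) = (if s then 1 else 0) + changes s ss

oddAnchors : ∀ {n} → SignedPerm n → ℕ
oddAnchors c = countOdd (map proj₂ (anchors (entries c)))

-- Let t_j be the type of the vertex added last among those labelled 1, …, j+1.  A vertex x is
-- an anchor exactly when it is that last vertex for j + 1 = x, and t_j stays constant
-- between consecutive anchors; hence the odd anchors are the changes in the sequence
-- t_0, …, t_{n-1}, a dominant t_0 counting as a change.  For j ≥ 1 the range holds at least
-- two vertices, and its last vertex is adjacent to all the others iff it is dominant, so t_j
-- is read off G.  The type t_0 of vertex 1 is forced too: if some construction adds 1 first,
-- sorting the remaining vertices within runs of equal sign yields the standard form with 1
-- in the first block, and the convention makes 1 dominant in both constructions; otherwise
-- both add some vertex before 1, and the adjacencies among 1 and these two vertices show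
-- that the types of 1 agree.

module Submission where

open import Defs
open import Data.Bool using (Bool; true; false; if_then_else_)
open import Data.Bool.Properties using () renaming (_≟_ to _≟B_)
open import Data.Empty using (⊥-elim)
open import Data.Fin using (Fin; toℕ; _<?_; _≟_; _<_) renaming (zero to fz; suc to fs)
open import Data.Fin.Properties using (toℕ<n; ≤∧≢⇒<)
open import Data.List using (List; []; _∷_; map; _++_; allFin)
open import Data.List.Properties using (map-++; ++-assoc)
open import Data.List.Membership.Propositional using (_∈_; _∉_)
open import Data.List.Membership.Propositional.Properties
  using (∈-allFin; ∈-map⁺; ∈-++⁺ˡ; ∈-++⁺ʳ; ∈-++⁻)
open import Data.List.Relation.Binary.Permutation.Propositional as ↭
  using (_↭_; prep; swap; ↭-sym; ↭⇒↭ₛ)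
open import Data.List.Relation.Binary.Permutation.Propositional.Properties using (∈-resp-↭)
import Data.List.Relation.Binary.Permutation.Setoid.Properties as ↭ₛ
open import Data.List.Relation.Unary.All as All using (All; []; _∷_)
open import Data.List.Relation.Unary.All.Properties using (map⁺)
open import Data.List.Relation.Unary.AllPairs using (_∷_)
open import Data.List.Relation.Unary.Any using (here; there)
open import Data.List.Relation.Unary.Unique.Propositional using (Unique)
open import Data.List.Relation.Unary.Unique.Propositional.Properties using (allFin⁺)
open import Data.Maybe using (Maybe; just; nothing; maybe′; _<∣>_; Is-just)
open import Data.Maybe.Relation.Unary.Any using (just)
open import Data.Nat as ℕ using (ℕ; zero; suc; _+_; _∸_; _≤_; z≤n; s≤s; _≤?_)
open import Data.Nat.Properties as ℕ using ()
open import Data.Product using (_×_; _,_; proj₁; proj₂; ∃; ∃₂)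
open import Data.Sum using (_⊎_; inj₁; inj₂)
open import Data.Unit using (⊤; tt)
open import Function using (_∘_)
open import Relation.Nullary using (yes; no)
open import Relation.Nullary.Decidable using (⌊_⌋)
open import Relation.Binary.PropositionalEquality
  using (_≡_; _≢_; refl; sym; trans; cong; subst; setoid; module ≡-Reasoning)

private variable
  n : ℕ

labels : List (Entry n) → List (Fin n)
labels = map proj₁

Distinct : List (Entry n) → Set
Distinct l = Unique (labels l)

entries-distinct : (c : SignedPerm n) → Distinct (entries c)
entries-distinct {n} c =
  ↭ₛ.Unique-resp-↭ (setoid (Fin n)) (↭⇒↭ₛ (↭-sym (isPerm c))) (allFin⁺ n)

∈-entries : (c : SignedPerm n) (u : Fin n) → u ∈ labels (entries c)
∈-entries c u = ∈-resp-↭ (↭-sym (isPerm c)) (∈-allFin u)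

module _ (c : SignedPerm n) {l : List (Entry n)} (eq : entries c ≡ l) where

  entries-distinct-≡ : Distinct l
  entries-distinct-≡ = subst Distinct eq (entries-distinct c)

  ∈-entries-≡ : ∀ u → u ∈ labels l
  ∈-entries-≡ u = subst (λ l′ → u ∈ labels l′) eq (∈-entries c u)

module _ (pre : List (Entry n)) {x : Fin n} {s : Bool} {post : List (Entry n)} where

  ∈-labels-middle : x ∈ labels (pre ++ (x , s) ∷ post)
  ∈-labels-middle = subst (x ∈_) (sym (map-++ proj₁ pre _)) (∈-++⁺ʳ (labels pre) (here refl))

  ∈-labels-prefix : ∀ {u} → u ∈ labels pre → u ∈ labels (pre ++ (x , s) ∷ post)
  ∈-labels-prefix u∈ = subst (_ ∈_) (sym (map-++ proj₁ pre _)) (∈-++⁺ˡ u∈)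

  ∈-labels-split : ∀ {u} → u ∈ labels (pre ++ (x , s) ∷ post) →
                   u ∈ labels pre ⊎ u ≡ x ⊎ u ∈ labels post
  ∈-labels-split u∈ with ∈-++⁻ (labels pre) (subst (_ ∈_) (map-++ proj₁ pre _) u∈)
  ... | inj₁ u∈pre          = inj₁ u∈pre
  ... | inj₂ (here u≡x)     = inj₂ (inj₁ u≡x)
  ... | inj₂ (there u∈post) = inj₂ (inj₂ u∈post)

∈-labels-decompose : ∀ {u : Fin n} l → u ∈ labels l →
                     ∃₂ λ pre post → ∃ λ t → l ≡ pre ++ (u , t) ∷ post
∈-labels-decompose ((_ , t) ∷ l) (here refl) = [] , l , t , refl
∈-labels-decompose (e ∷ l) (there u∈) with ∈-labels-decompose l u∈
... | pre , post , t , refl = e ∷ pre , post , t , refl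

∉-prefix : ∀ pre {x : Fin n} {s post} → Distinct (pre ++ (x , s) ∷ post) → x ∉ labels pre
∉-prefix (_ ∷ pre) (y∉ ∷ _) (here refl) = All.lookup y∉ (∈-labels-middle pre) refl
∉-prefix (_ ∷ pre) (_ ∷ d) (there x∈) = ∉-prefix pre d x∈

laterSign-middle : ∀ pre {x : Fin n} {s post} → x ∉ labels pre →
                   laterSign (pre ++ (x , s) ∷ post) x ≡ s
laterSign-middle [] {x} _ with x ≟ x
... | yes _   = refl
... | no x≢x = ⊥-elim (x≢x refl)
laterSign-middle ((y , _) ∷ pre) {x} x∉ with y ≟ x
... | yes refl = ⊥-elim (x∉ (here refl))
... | no _     = laterSign-middle pre (x∉ ∘ there)

adjL-sym : ∀ (l : List (Entry n)) u v → adjL l u v ≡ adjL l v u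
adjL-sym [] u v = refl
adjL-sym ((x , s) ∷ r) u v with x ≟ u | x ≟ v
... | yes refl | yes refl = refl
... | yes refl | no _     = refl
... | no _     | yes refl = refl
... | no _     | no _     = adjL-sym r u v

adjL-to-later : ∀ pre {x : Fin n} {s post u} → Distinct (pre ++ (x , s) ∷ post) →
                u ∈ labels pre → adjL (pre ++ (x , s) ∷ post) u x ≡ s
adjL-to-later ((y , _) ∷ pre) {x} {u = u} (y∉ ∷ d) u∈ with y ≟ u
... | yes refl = laterSign-middle pre (∉-prefix pre d)
... | no y≢u with y ≟ x | u∈
...   | yes refl | _          = ⊥-elim (All.lookup y∉ (∈-labels-middle pre) refl)
...   | no _     | here refl  = ⊥-elim (y≢u refl)
...   | no _     | there u∈′ = adjL-to-later pre d u∈′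

module Construction {G : Graph n} (c : SignedPerm n) (cG : IsConstructionOf c G) where

  G-sym : ∀ u v → G u v ≡ G v u
  G-sym u v = trans (sym (cG u v)) (trans (adjL-sym (entries c) u v) (cG v u))

  type-from-earlier : ∀ pre {x s post u} → entries c ≡ pre ++ (x , s) ∷ post →
                      u ∈ labels pre → G u x ≡ s
  type-from-earlier pre {x} {s} {post} {u} eq u∈ = begin
    G u x                            ≡⟨ sym (cG u x) ⟩
    adjL (entries c) u x             ≡⟨ cong (λ l → adjL l u x) eq ⟩
    adjL (pre ++ (x , s) ∷ post) u x ≡⟨ adjL-to-later pre (entries-distinct-≡ c eq) u∈ ⟩
    s                                ∎
    where open ≡-Reasoning

  earlier-agree-on-later : ∀ pre {x s post u w} → entries c ≡ pre ++ (x , s) ∷ post →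
                           u ∈ labels pre → w ∈ labels post → G u w ≡ G x w
  earlier-agree-on-later pre {x} {s} eq u∈ w∈ with ∈-labels-decompose _ w∈
  ... | mid , post′ , t , refl =
    trans (type-from-earlier pre′ eq′ (∈-labels-prefix pre u∈))
          (sym (type-from-earlier pre′ eq′ (∈-labels-middle pre)))
    where
    pre′ : List (Entry n)
    pre′ = pre ++ (x , s) ∷ mid
    eq′ : entries c ≡ pre′ ++ (_ , t) ∷ post′
    eq′ = trans eq (sym (++-assoc pre ((x , s) ∷ mid) _))

-- The type of the vertex added last among those with label at most j (labels count from 0).
lastTypeUpTo : ℕ → List (Entry n) → Maybe Bool
lastTypeUpTo j [] = nothing
lastTypeUpTo j ((x , s) ∷ r) =
  lastTypeUpTo j r <∣> (if ⌊ toℕ x ≤? j ⌋ then just s else nothing)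

LabelsAbove : ℕ → List (Entry n) → Set
LabelsAbove j = All (λ e → j ℕ.< toℕ (proj₁ e))

lastTypeUpTo-above : ∀ j (r : List (Entry n)) → LabelsAbove j r → lastTypeUpTo j r ≡ nothing
lastTypeUpTo-above j [] _ = refl
lastTypeUpTo-above j ((x , s) ∷ r) (j<x ∷ above)
  rewrite lastTypeUpTo-above j r above with toℕ x ≤? j
... | yes x≤j = ⊥-elim (ℕ.<⇒≱ j<x x≤j)
... | no _    = refl

lastTypeUpTo-nothing : ∀ j (r : List (Entry n)) → lastTypeUpTo j r ≡ nothing →
                       ∀ {y} → y ∈ labels r → j ℕ.< toℕ y
lastTypeUpTo-nothing j ((x , s) ∷ r) undef y∈
  with lastTypeUpTo j r in undef′ | toℕ x ≤? j | y∈
lastTypeUpTo-nothing j ((x , s) ∷ r) () y∈ | just _  | _     | _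
lastTypeUpTo-nothing j ((x , s) ∷ r) () y∈ | nothing | yes _ | _
... | nothing | no x≰j | here refl  = ℕ.≰⇒> x≰j
... | nothing | no _   | there y∈′ = lastTypeUpTo-nothing j r undef′ y∈′

lastTypeUpTo-defined : ∀ j (r : List (Entry n)) {y} → y ∈ labels r → toℕ y ≤ j →
                       ∃ λ b → lastTypeUpTo j r ≡ just b
lastTypeUpTo-defined j r y∈ y≤j with lastTypeUpTo j r in eq
... | just b  = b , refl
... | nothing = ⊥-elim (ℕ.<⇒≱ (lastTypeUpTo-nothing j r eq y∈) y≤j)

lastTypeUpTo-upward : ∀ (r : List (Entry n)) {i j} → i ≤ j →
                      Is-just (lastTypeUpTo i r) → Is-just (lastTypeUpTo j r)
lastTypeUpTo-upward ((x , s) ∷ r) {i} {j} i≤j def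
  with lastTypeUpTo i r in eqi | lastTypeUpTo j r in eqj
... | _      | just _  = just tt
... | just _ | nothing
  with subst Is-just eqj (lastTypeUpTo-upward r i≤j (subst Is-just (sym eqi) (just tt)))
...   | ()
lastTypeUpTo-upward ((x , s) ∷ r) {i} {j} i≤j def | nothing | nothing
  with toℕ x ≤? i | toℕ x ≤? j | def
... | _       | yes _  | _  = just tt
... | yes x≤i | no x≰j | _  = ⊥-elim (x≰j (ℕ.≤-trans x≤i i≤j))
... | no _    | no _   | ()

lastTypeUpTo-split : ∀ j (l : List (Entry n)) {s} → lastTypeUpTo j l ≡ just s →
  ∃₂ λ pre post → ∃ λ x → l ≡ pre ++ (x , s) ∷ post × toℕ x ≤ j × LabelsAbove j post
lastTypeUpTo-split j ((x , t) ∷ r) eq with lastTypeUpTo j r in eq′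
... | just _ with lastTypeUpTo-split j r eq′ | eq
...   | pre , post , y , refl , y≤j , above | refl = (x , t) ∷ pre , post , y , refl , y≤j , above
lastTypeUpTo-split j ((x , t) ∷ r) eq | nothing with toℕ x ≤? j | eq
... | yes x≤j | refl =
  [] , r , x , refl , x≤j , All.tabulate (lastTypeUpTo-nothing j r eq′ ∘ ∈-map⁺ proj₁)
lastTypeUpTo-split j ((x , t) ∷ r) eq | nothing | no _ | ()

change : Bool → Bool → ℕ
change s p = if ⌊ s ≟B p ⌋ then 0 else 1

change-refl : ∀ p → change p p ≡ 0
change-refl false = refl
change-refl true  = refl

changesAlong : Bool → (ℕ → Maybe Bool) → ℕ → ℕ → ℕ
changesAlong p g k zero    = 0
changesAlong p g k (suc f) =
  maybe′ (λ s → change s p + changesAlong s g (suc k) f) (changesAlong p g (suc k) f) (g k)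

changesAlong-cong : ∀ p {g h} k f → (∀ j → k ≤ j → g j ≡ h j) →
                    changesAlong p g k f ≡ changesAlong p h k f
changesAlong-cong p k zero    _   = refl
changesAlong-cong p {g} {h} k (suc f) g≗h with g k | h k | g≗h k ℕ.≤-refl
... | nothing | .nothing  | refl = changesAlong-cong p (suc k) f (λ j → g≗h j ∘ ℕ.<⇒≤)
... | just s  | .(just s) | refl =
  cong (change s p +_) (changesAlong-cong s (suc k) f (λ j → g≗h j ∘ ℕ.<⇒≤))

changesAlong-skip : ∀ p g k d f → (∀ j → j ℕ.< k + d → g j ≡ nothing) →
                    changesAlong p g k (d + f) ≡ changesAlong p g (k + d) f
changesAlong-skip p g k zero    f _ = cong (λ k′ → changesAlong p g k′ f) (sym (ℕ.+-identityʳ k))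
changesAlong-skip p g k (suc d) f undef = begin
  changesAlong p g k (suc d + f)    ≡⟨ cong (maybe′ _ _) (undef k (ℕ.m<m+n k ℕ.z<s)) ⟩
  changesAlong p g (suc k) (d + f)  ≡⟨ changesAlong-skip p g (suc k) d f undef′ ⟩
  changesAlong p g (suc k + d) f    ≡⟨ cong (λ k′ → changesAlong p g k′ f) (sym (ℕ.+-suc k d)) ⟩
  changesAlong p g (k + suc d) f    ∎
  where
  open ≡-Reasoning
  undef′ : ∀ j → j ℕ.< suc k + d → g j ≡ nothing
  undef′ j = undef j ∘ subst (j ℕ.<_) (sym (ℕ.+-suc k d))

changesAlong-undefined : ∀ p g k f → (∀ j → g j ≡ nothing) → changesAlong p g k f ≡ 0
changesAlong-undefined p g k zero    _     = refl
changesAlong-undefined p g k (suc f) undef =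
  trans (cong (maybe′ _ _) (undef k)) (changesAlong-undefined p g (suc k) f undef)

UpwardDefined : (ℕ → Maybe Bool) → Set
UpwardDefined g = ∀ {i j} → i ≤ j → Is-just (g i) → Is-just (g j)

<∣>-defined : ∀ {m : Maybe Bool} m′ → Is-just m → (m <∣> m′) ≡ m
<∣>-defined _ (just _) = refl

-- Undefined values of an upward defined sequence all come first, so filling them with the
-- starting type p creates no change.
changesAlong-fill : ∀ p {g h} k f → UpwardDefined g →
                    (∀ j → k ≤ j → h j ≡ (g j <∣> just p)) →
                    changesAlong p h k f ≡ changesAlong p g k f
changesAlong-fill p k zero    _  _ = refl
changesAlong-fill p {g} {h} k (suc f) up h≗ with g k in eq | h k | h≗ k ℕ.≤-refl
... | nothing | .(just p) | refl =
  trans (cong (_+ changesAlong p h (suc k) f) (change-refl p))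
        (changesAlong-fill p (suc k) f up (λ j → h≗ j ∘ ℕ.<⇒≤))
... | just b  | .(just b) | refl = cong (change b p +_) (changesAlong-cong b (suc k) f h≡g)
  where
  h≡g : ∀ j → suc k ≤ j → h j ≡ g j
  h≡g j k<j = trans (h≗ j (ℕ.<⇒≤ k<j))
                    (<∣>-defined (just p) (up (ℕ.<⇒≤ k<j) (subst Is-just (sym eq) (just tt))))

anchorTypes : List (Entry n) → List Bool
anchorTypes l = map proj₂ (anchors l)

smallerThanAll-true : ∀ (x : Fin n) r → smallerThanAll x r ≡ true → LabelsAbove (toℕ x) r
smallerThanAll-true x []            _ = []
smallerThanAll-true x ((y , _) ∷ r) eq with x <? y
... | yes x<y = x<y ∷ smallerThanAll-true x r eq

smallerThanAll-false : ∀ (x : Fin n) r → smallerThanAll x r ≡ false →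
                       ∃ λ y → y ∈ labels r × toℕ y ≤ toℕ x
smallerThanAll-false x ((y , _) ∷ r) eq with x <? y
... | no x≮y = y , here refl , ℕ.≮⇒≥ x≮y
... | yes _ with smallerThanAll-false x r eq
...   | z , z∈ , z≤x = z , there z∈ , z≤x

lastTypeUpTo-nonAnchor : ∀ (x : Fin n) s r → smallerThanAll x r ≡ false →
                         ∀ j → lastTypeUpTo j ((x , s) ∷ r) ≡ lastTypeUpTo j r
lastTypeUpTo-nonAnchor x s r notAnchor j with lastTypeUpTo j r in undef
... | just _  = refl
... | nothing with smallerThanAll-false x r notAnchor | toℕ x ≤? j
...   | y , y∈ , y≤x | yes x≤j =
  ⊥-elim (ℕ.<⇒≱ (lastTypeUpTo-nothing j r undef y∈) (ℕ.≤-trans y≤x x≤j))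
...   | _            | no _    = refl

changesAlong-anchor : ∀ p (x : Fin n) s r → LabelsAbove (toℕ x) r →
  changesAlong p (λ j → lastTypeUpTo j ((x , s) ∷ r)) 0 n ≡
  change s p + changesAlong s (λ j → lastTypeUpTo j r) 0 n
changesAlong-anchor {n} p x s r above = begin
  changesAlong p g 0 n
    ≡⟨ cong (changesAlong p g 0) n≡x+[1+f] ⟩
  changesAlong p g 0 (toℕ x + suc f)
    ≡⟨ changesAlong-skip p g 0 (toℕ x) (suc f) g-below ⟩
  changesAlong p g (toℕ x) (suc f)
    ≡⟨ cong (maybe′ _ _) g-at ⟩
  change s p + changesAlong s g (suc (toℕ x)) f
    ≡⟨ cong (change s p +_) (changesAlong-fill s (suc (toℕ x)) f (lastTypeUpTo-upward r) g-above) ⟩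
  change s p + changesAlong s gr (suc (toℕ x)) f
    ≡⟨ cong (change s p +_) (sym (changesAlong-skip s gr 0 (suc (toℕ x)) f
                                    (λ j → gr-below j ∘ ℕ.≤-pred))) ⟩
  change s p + changesAlong s gr 0 (suc (toℕ x) + f)
    ≡⟨ cong (λ k → change s p + changesAlong s gr 0 k) (sym (trans n≡x+[1+f] (ℕ.+-suc (toℕ x) f))) ⟩
  change s p + changesAlong s gr 0 n
    ∎
  where
  open ≡-Reasoning
  g gr : ℕ → Maybe Bool
  g j  = lastTypeUpTo j ((x , s) ∷ r)
  gr j = lastTypeUpTo j r
  f : ℕ
  f = n ∸ suc (toℕ x)
  n≡x+[1+f] : n ≡ toℕ x + suc f
  n≡x+[1+f] = sym (trans (ℕ.+-suc (toℕ x) f) (ℕ.m+[n∸m]≡n (toℕ<n x)))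
  gr-below : ∀ j → j ≤ toℕ x → gr j ≡ nothing
  gr-below j j≤x = lastTypeUpTo-above j r (All.map (ℕ.≤-<-trans j≤x) above)
  g-below : ∀ j → j ℕ.< toℕ x → g j ≡ nothing
  g-below j j<x rewrite gr-below j (ℕ.<⇒≤ j<x) with toℕ x ≤? j
  ... | yes x≤j = ⊥-elim (ℕ.<⇒≱ j<x x≤j)
  ... | no _    = refl
  g-at : g (toℕ x) ≡ just s
  g-at rewrite gr-below (toℕ x) ℕ.≤-refl with toℕ x ≤? toℕ x
  ... | yes _   = refl
  ... | no x≰x = ⊥-elim (x≰x ℕ.≤-refl)
  g-above : ∀ j → suc (toℕ x) ≤ j → g j ≡ (gr j <∣> just s)
  g-above j x<j with toℕ x ≤? j
  ... | yes _   = refl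
  ... | no x≰j = ⊥-elim (x≰j (ℕ.<⇒≤ x<j))

changes-anchorTypes : ∀ p (l : List (Entry n)) →
                      changes p (anchorTypes l) ≡ changesAlong p (λ j → lastTypeUpTo j l) 0 n
changes-anchorTypes {n} p [] = sym (changesAlong-undefined p _ 0 n (λ _ → refl))
changes-anchorTypes {n} p ((x , s) ∷ r) with smallerThanAll x r in anchor
... | false = trans (changes-anchorTypes p r)
                    (changesAlong-cong p 0 n (λ j _ → sym (lastTypeUpTo-nonAnchor x s r anchor j)))
... | true  = trans (cong (change s p +_) (changes-anchorTypes s r))
                    (sym (changesAlong-anchor p x s r (smallerThanAll-true x r anchor)))

-- The first anchor is odd iff dominant: it counts as a change from a recessive predecessor.
countOdd≡changes-from-recessive : ∀ ss → countOdd ss ≡ changes false ss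
countOdd≡changes-from-recessive []          = refl
countOdd≡changes-from-recessive (false ∷ _) = refl
countOdd≡changes-from-recessive (true ∷ _)  = refl

record _≃_ (l l′ : List (Entry n)) : Set where
  constructor mk≃
  field
    adjL-≡      : ∀ u v → adjL l u v ≡ adjL l′ u v
    laterSign-≡ : ∀ w → laterSign l w ≡ laterSign l′ w
open _≃_

≃-refl : {l : List (Entry n)} → l ≃ l
≃-refl = mk≃ (λ _ _ → refl) (λ _ → refl)

≃-trans : {l₁ l₂ l₃ : List (Entry n)} → l₁ ≃ l₂ → l₂ ≃ l₃ → l₁ ≃ l₃
≃-trans (mk≃ adj₁₂ sign₁₂) (mk≃ adj₂₃ sign₂₃) =
  mk≃ (λ u v → trans (adj₁₂ u v) (adj₂₃ u v)) (λ w → trans (sign₁₂ w) (sign₂₃ w))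

≃-cons : ∀ {l l′ : List (Entry n)} e → l ≃ l′ → (e ∷ l) ≃ (e ∷ l′)
≃-cons {l = l} {l′} (x , s) (mk≃ adj sign) = mk≃ adj′ sign′
  where
  adj′ : ∀ u v → adjL ((x , s) ∷ l) u v ≡ adjL ((x , s) ∷ l′) u v
  adj′ u v with x ≟ u | x ≟ v
  ... | yes _ | _     = sign v
  ... | no _  | yes _ = sign u
  ... | no _  | no _  = adj u v
  sign′ : ∀ w → laterSign ((x , s) ∷ l) w ≡ laterSign ((x , s) ∷ l′) w
  sign′ w with x ≟ w
  ... | yes _ = refl
  ... | no _  = sign w

≃-swap : ∀ (a b : Fin n) s r → ((a , s) ∷ (b , s) ∷ r) ≃ ((b , s) ∷ (a , s) ∷ r)
≃-swap a b s r = mk≃ adj sign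
  where
  sign : ∀ w → laterSign ((a , s) ∷ (b , s) ∷ r) w ≡ laterSign ((b , s) ∷ (a , s) ∷ r) w
  sign w with a ≟ w | b ≟ w
  ... | yes _ | yes _ = refl
  ... | yes _ | no _  = refl
  ... | no _  | yes _ = refl
  ... | no _  | no _  = refl
  adj : ∀ u v → adjL ((a , s) ∷ (b , s) ∷ r) u v ≡ adjL ((b , s) ∷ (a , s) ∷ r) u v
  adj u v with a ≟ u | b ≟ u | a ≟ v | b ≟ v
  ... | yes refl | yes refl | yes refl | no b≢v = ⊥-elim (b≢v refl)
  ... | yes refl | yes refl | no a≢v   | yes refl = ⊥-elim (a≢v refl)
  ... | yes _ | yes _ | yes _ | yes _ = refl
  ... | yes _ | yes _ | no _  | no _  = refl
  ... | yes _ | no _  | yes _ | yes _ = refl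
  ... | yes _ | no _  | yes _ | no _  = refl
  ... | yes _ | no _  | no _  | yes _ = refl
  ... | yes _ | no _  | no _  | no _  = refl
  ... | no _  | yes _ | yes _ | yes _ = refl
  ... | no _  | yes _ | yes _ | no _  = refl
  ... | no _  | yes _ | no _  | yes _ = refl
  ... | no _  | yes _ | no _  | no _  = refl
  ... | no _  | no _  | yes _ | yes _ = refl
  ... | no _  | no _  | yes _ | no _  = refl
  ... | no _  | no _  | no _  | yes _ = refl
  ... | no _  | no _  | no _  | no _  = refl

-- Insertion within a run of equal signs: an entry never moves past one of the other sign,
-- so (by ≃-swap) the constructed graph is unchanged.
insertInRun : Entry n → List (Entry n) → List (Entry n)
insertInRun e [] = e ∷ []
insertInRun (x , s) ((y , t) ∷ r) with t ≟B s | y <? x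
... | yes _ | yes _ = (y , t) ∷ insertInRun (x , s) r
... | yes _ | no _  = (x , s) ∷ (y , t) ∷ r
... | no _  | _     = (x , s) ∷ (y , t) ∷ r

sortRuns : List (Entry n) → List (Entry n)
sortRuns []      = []
sortRuns (e ∷ r) = insertInRun e (sortRuns r)

insertInRun-≃ : ∀ (e : Entry n) l → insertInRun e l ≃ (e ∷ l)
insertInRun-≃ e [] = ≃-refl
insertInRun-≃ (x , s) ((y , t) ∷ r) with t ≟B s | y <? x
... | yes refl | yes _ = ≃-trans (≃-cons (y , s) (insertInRun-≃ (x , s) r)) (≃-swap y x s r)
... | yes _    | no _  = ≃-refl
... | no _     | _     = ≃-refl

sortRuns-≃ : ∀ (l : List (Entry n)) → sortRuns l ≃ l
sortRuns-≃ []      = ≃-refl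
sortRuns-≃ (e ∷ r) = ≃-trans (insertInRun-≃ e (sortRuns r)) (≃-cons e (sortRuns-≃ r))

insertInRun-↭ : ∀ (e : Entry n) l → labels (insertInRun e l) ↭ proj₁ e ∷ labels l
insertInRun-↭ e [] = ↭.refl
insertInRun-↭ (x , s) ((y , t) ∷ r) with t ≟B s | y <? x
... | yes _ | yes _ = ↭.trans (prep y (insertInRun-↭ (x , s) r)) (swap y x ↭.refl)
... | yes _ | no _  = ↭.refl
... | no _  | _     = ↭.refl

sortRuns-↭ : ∀ (l : List (Entry n)) → labels (sortRuns l) ↭ labels l
sortRuns-↭ []            = ↭.refl
sortRuns-↭ ((x , s) ∷ r) = ↭.trans (insertInRun-↭ (x , s) (sortRuns r)) (prep x (sortRuns-↭ r))

sortRuns-nonempty : ∀ (e : Entry n) l → sortRuns (e ∷ l) ≢ []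
sortRuns-nonempty e l = nonempty e (sortRuns l)
  where
  nonempty : ∀ (e : Entry n) l → insertInRun e l ≢ []
  nonempty e [] ()
  nonempty (x , s) ((y , t) ∷ r) with t ≟B s | y <? x
  ... | yes _ | yes _ = λ ()
  ... | yes _ | no _  = λ ()
  ... | no _  | _     = λ ()

SameSignIncrToHead : Entry n → List (Entry n) → Set
SameSignIncrToHead a []      = ⊤
SameSignIncrToHead a (b ∷ _) = proj₂ a ≡ proj₂ b → proj₁ a < proj₁ b

sameSignIncr-∷ : ∀ {a : Entry n} {l} → SameSignIncrToHead a l → SameSignIncr l →
                 SameSignIncr (a ∷ l)
sameSignIncr-∷ {l = []}    _ _ = tt
sameSignIncr-∷ {l = _ ∷ _} h s = h , s

sameSignIncr-head : ∀ {a : Entry n} l → SameSignIncr (a ∷ l) → SameSignIncrToHead a l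
sameSignIncr-head []      _       = tt
sameSignIncr-head (_ ∷ _) (h , _) = h

sameSignIncr-tail : ∀ {a : Entry n} l → SameSignIncr (a ∷ l) → SameSignIncr l
sameSignIncr-tail []      _       = tt
sameSignIncr-tail (_ ∷ _) (_ , s) = s

insertInRun-toHead : ∀ (a : Entry n) x s r → SameSignIncrToHead a ((x , s) ∷ []) →
                     SameSignIncrToHead a r → SameSignIncrToHead a (insertInRun (x , s) r)
insertInRun-toHead a x s []            hx _  = hx
insertInRun-toHead a x s ((y , t) ∷ r) hx hr with t ≟B s | y <? x
... | yes _ | yes _ = hr
... | yes _ | no _  = hx
... | no _  | _     = hx

insertInRun-sameSignIncr : ∀ (x : Fin n) s l → x ∉ labels l → SameSignIncr l →
                           SameSignIncr (insertInRun (x , s) l)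
insertInRun-sameSignIncr x s []            _  _    = tt
insertInRun-sameSignIncr x s ((y , t) ∷ r) x∉ incr with t ≟B s | y <? x
... | yes _ | yes y<x =
  sameSignIncr-∷ (insertInRun-toHead (y , t) x s r (λ _ → y<x) (sameSignIncr-head r incr))
                 (insertInRun-sameSignIncr x s r (x∉ ∘ there) (sameSignIncr-tail r incr))
... | yes _ | no y≮x = (λ _ → ≤∧≢⇒< (ℕ.≮⇒≥ y≮x) (λ x≡y → x∉ (here x≡y))) , incr
... | no t≢s | _     = (λ s≡t → ⊥-elim (t≢s (sym s≡t))) , incr

sortRuns-sameSignIncr : ∀ (l : List (Entry n)) → Distinct l → SameSignIncr (sortRuns l)
sortRuns-sameSignIncr []            _          = tt
sortRuns-sameSignIncr ((x , s) ∷ r) (x∉ ∷ d) =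
  insertInRun-sameSignIncr x s (sortRuns r)
    (λ x∈ → All.lookup x∉ (∈-resp-↭ (sortRuns-↭ r) x∈) refl) (sortRuns-sameSignIncr r d)

vertexOne-first⇒oneInFirstBlock : ∀ {m} {G : Graph (suc (suc m))} (c : SignedPerm (suc (suc m))) →
  IsConstructionOf c G → ∀ {a post} → entries c ≡ (fz , a) ∷ post → OneInFirstBlock G
vertexOne-first⇒oneInFirstBlock c cG {post = []} eq
  with ∈-entries-≡ c eq (fs fz)
... | here ()
... | there ()
vertexOne-first⇒oneInFirstBlock {m} {G} c cG {a} {e ∷ post} eq
  with entries-distinct-≡ c eq
... | fz∉ ∷ distinct
  with sortRuns (e ∷ post) | sortRuns-≃ (e ∷ post) | sortRuns-↭ (e ∷ post)
     | sortRuns-sameSignIncr (e ∷ post) distinct | sortRuns-nonempty e post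
... | []             | _       | _       | _    | nonempty = ⊥-elim (nonempty refl)
... | (y , t) ∷ rest | sorted≃ | sorted↭ | incr | _        =
  S , S-builds-G , (refl , fz<y , incr) , here refl
  where
  labels-perm : fz ∷ labels (e ∷ post) ↭ allFin (suc (suc m))
  labels-perm = subst (λ l → labels l ↭ allFin _) eq (isPerm c)
  S : SignedPerm (suc (suc m))
  S = mkSP ((fz , t) ∷ (y , t) ∷ rest) (↭.trans (prep fz sorted↭) labels-perm)
  -- adjL ignores the type of the first vertex, so it may be changed from a to t.
  S-builds-G : IsConstructionOf S G
  S-builds-G u v = trans (adjL-≡ (≃-cons (fz , t) sorted≃) u v)
                         (trans (cong (λ l → adjL l u v) (sym eq)) (cG u v))
  fz<y : t ≡ t → fz {suc m} < y
  fz<y _ = fz<other y (∈-resp-↭ sorted↭ (here refl))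
    where
    fz<other : ∀ (z : Fin (suc (suc m))) → z ∈ labels (e ∷ post) → fz {suc m} < z
    fz<other fz     fz∈ = ⊥-elim (All.lookup fz∉ fz∈ refl)
    fz<other (fs _) _   = ℕ.z<s

lastTypeUpTo-adjacency : ∀ {G : Graph n} (c : SignedPerm n) → IsConstructionOf c G → ∀ j {s} →
  lastTypeUpTo j (entries c) ≡ just s →
  ∃ λ x → toℕ x ≤ j × (∀ u → toℕ u ≤ j → u ≢ x → G u x ≡ s)
lastTypeUpTo-adjacency {G = G} c cG j {s} last with lastTypeUpTo-split j (entries c) last
... | pre , post , x , eq , x≤j , above = x , x≤j , earlier
  where
  earlier : ∀ u → toℕ u ≤ j → u ≢ x → G u x ≡ s
  earlier u u≤j u≢x with ∈-labels-split pre (∈-entries-≡ c eq u)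
  ... | inj₁ u∈pre         = Construction.type-from-earlier c cG pre eq u∈pre
  ... | inj₂ (inj₁ u≡x)    = ⊥-elim (u≢x u≡x)
  ... | inj₂ (inj₂ u∈post) = ⊥-elim (ℕ.<⇒≱ (All.lookup (map⁺ above) u∈post) u≤j)

another-vertex-upTo : ∀ {m} j → 1 ≤ j → (x : Fin (suc (suc m))) → ∃ λ u → toℕ u ≤ j × u ≢ x
another-vertex-upTo j 1≤j fz     = fs fz , 1≤j , λ ()
another-vertex-upTo j 1≤j (fs _) = fz , z≤n , λ ()

lastTypeUpTo-zero : ∀ {m} (l : List (Entry (suc m))) {a} → lastTypeUpTo 0 l ≡ just a →
                    ∃₂ λ pre post → l ≡ pre ++ (fz , a) ∷ post
lastTypeUpTo-zero l last with lastTypeUpTo-split 0 l last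
... | pre , post , fz , eq , _ , _ = pre , post , eq

≢fz⇒LabelsAbove0 : ∀ {m} (r : List (Entry (suc m))) → All (fz ≢_) (labels r) → LabelsAbove 0 r
≢fz⇒LabelsAbove0 []               []             = []
≢fz⇒LabelsAbove0 ((fz   , _) ∷ r) (fz≢fz ∷ _)    = ⊥-elim (fz≢fz refl)
≢fz⇒LabelsAbove0 ((fs _ , _) ∷ r) (_ ∷ r≢fz)    = ℕ.z<s ∷ ≢fz⇒LabelsAbove0 r r≢fz

convention⇒vertexOne-dominant : ∀ {m} {G : Graph (suc m)} (c : SignedPerm (suc m)) →
  FollowsConvention c G → OneInFirstBlock G → lastTypeUpTo 0 (entries c) ≡ just true
convention⇒vertexOne-dominant c conv inFirst with conv inFirst
... | fz , rest , _ , eq with entries-distinct-≡ c eq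
...   | fz∉ ∷ _ rewrite eq | lastTypeUpTo-above 0 rest (≢fz⇒LabelsAbove0 rest fz∉) = refl

module _ {m} {G : Graph (suc (suc m))} (c₁ c₂ : SignedPerm (suc (suc m)))
         (cG₁ : IsConstructionOf c₁ G) (cG₂ : IsConstructionOf c₂ G) where

  module C₁ = Construction c₁ cG₁
  module C₂ = Construction c₂ cG₂

  lastTypeUpTo-determined : ∀ j → 1 ≤ j → lastTypeUpTo j (entries c₁) ≡ lastTypeUpTo j (entries c₂)
  lastTypeUpTo-determined j 1≤j
    with lastTypeUpTo-defined j (entries c₁) (∈-entries c₁ fz) z≤n
       | lastTypeUpTo-defined j (entries c₂) (∈-entries c₂ fz) z≤n
  ... | s₁ , last₁ | s₂ , last₂
    with lastTypeUpTo-adjacency c₁ cG₁ j last₁ | lastTypeUpTo-adjacency c₂ cG₂ j last₂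
  ... | x₁ , x₁≤j , adj₁ | x₂ , x₂≤j , adj₂ = trans last₁ (trans (cong just s₁≡s₂) (sym last₂))
    where
    s₁≡s₂ : s₁ ≡ s₂
    s₁≡s₂ with x₁ ≟ x₂
    ... | no x₁≢x₂ =
      trans (sym (adj₁ x₂ x₂≤j (x₁≢x₂ ∘ sym))) (trans (C₁.G-sym x₂ x₁) (adj₂ x₁ x₁≤j x₁≢x₂))
    ... | yes refl with another-vertex-upTo j 1≤j x₁
    ...   | u , u≤j , u≢x = trans (sym (adj₁ u u≤j u≢x)) (adj₂ u u≤j u≢x)

  vertexOne-type-preceded :
    ∀ pre₁ {a₁ post₁ u₁} → entries c₁ ≡ pre₁ ++ (fz , a₁) ∷ post₁ → u₁ ∈ labels pre₁ →
    ∀ pre₂ {a₂ post₂ u₂} → entries c₂ ≡ pre₂ ++ (fz , a₂) ∷ post₂ → u₂ ∈ labels pre₂ →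
    a₁ ≡ a₂
  vertexOne-type-preceded pre₁ {a₁} {u₁ = u₁} eq₁ u₁∈ pre₂ {a₂} {u₂ = u₂} eq₂ u₂∈
    with ∈-labels-split pre₁ (∈-entries-≡ c₁ eq₁ u₂)
       | ∈-labels-split pre₂ (∈-entries-≡ c₂ eq₂ u₁)
  ... | inj₁ u₂-before | _ =
    trans (sym (C₁.type-from-earlier pre₁ eq₁ u₂-before)) (C₂.type-from-earlier pre₂ eq₂ u₂∈)
  ... | _ | inj₁ u₁-before =
    trans (sym (C₁.type-from-earlier pre₁ eq₁ u₁∈)) (C₂.type-from-earlier pre₂ eq₂ u₁-before)
  ... | inj₂ (inj₁ refl) | _ = ⊥-elim (∉-prefix pre₂ (entries-distinct-≡ c₂ eq₂) u₂∈)
  ... | _ | inj₂ (inj₁ refl) = ⊥-elim (∉-prefix pre₁ (entries-distinct-≡ c₁ eq₁) u₁∈)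
  ... | inj₂ (inj₂ u₂-after) | inj₂ (inj₂ u₁-after) = begin
    a₁       ≡⟨ sym (C₁.type-from-earlier pre₁ eq₁ u₁∈) ⟩
    G u₁ fz  ≡⟨ C₁.G-sym u₁ fz ⟩
    G fz u₁  ≡⟨ sym (C₂.earlier-agree-on-later pre₂ eq₂ u₂∈ u₁-after) ⟩
    G u₂ u₁  ≡⟨ C₁.G-sym u₂ u₁ ⟩
    G u₁ u₂  ≡⟨ C₁.earlier-agree-on-later pre₁ eq₁ u₁∈ u₂-after ⟩
    G fz u₂  ≡⟨ C₁.G-sym fz u₂ ⟩
    G u₂ fz  ≡⟨ C₂.type-from-earlier pre₂ eq₂ u₂∈ ⟩
    a₂       ∎
    where open ≡-Reasoning

  module _ (conv₁ : FollowsConvention c₁ G) (conv₂ : FollowsConvention c₂ G) where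

    oneInFirstBlock⇒vertexOne-agrees : OneInFirstBlock G →
                                       lastTypeUpTo 0 (entries c₁) ≡ lastTypeUpTo 0 (entries c₂)
    oneInFirstBlock⇒vertexOne-agrees inFirst =
      trans (convention⇒vertexOne-dominant c₁ conv₁ inFirst)
            (sym (convention⇒vertexOne-dominant c₂ conv₂ inFirst))

    vertexOne-type-agrees : lastTypeUpTo 0 (entries c₁) ≡ lastTypeUpTo 0 (entries c₂)
    vertexOne-type-agrees
      with lastTypeUpTo-defined 0 (entries c₁) (∈-entries c₁ fz) z≤n
         | lastTypeUpTo-defined 0 (entries c₂) (∈-entries c₂ fz) z≤n
    ... | a₁ , last₁ | a₂ , last₂ with lastTypeUpTo-zero _ last₁ | lastTypeUpTo-zero _ last₂
    ... | [] , _ , eq₁ | _ =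
      oneInFirstBlock⇒vertexOne-agrees (vertexOne-first⇒oneInFirstBlock c₁ cG₁ eq₁)
    ... | _ | [] , _ , eq₂ =
      oneInFirstBlock⇒vertexOne-agrees (vertexOne-first⇒oneInFirstBlock c₂ cG₂ eq₂)
    ... | pre₁@(_ ∷ _) , _ , eq₁ | pre₂@(_ ∷ _) , _ , eq₂ =
      trans last₁ (trans (cong just (vertexOne-type-preceded pre₁ eq₁ (here refl) pre₂ eq₂ (here refl)))
                         (sym last₂))

oddAnchors≡changesAlong : (c : SignedPerm n) →
  oddAnchors c ≡ changesAlong false (λ j → lastTypeUpTo j (entries c)) 0 n
oddAnchors≡changesAlong c =
  trans (countOdd≡changes-from-recessive (anchorTypes (entries c)))
        (changes-anchorTypes false (entries c))

lemma5p10 : (n : ℕ) → 2 ≤ n → (G : Graph n) → IsLabeledThreshold G →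
    (c₁ c₂ : SignedPerm n) →
    IsConstructionOf c₁ G → FollowsConvention c₁ G →
    IsConstructionOf c₂ G → FollowsConvention c₂ G →
    oddAnchors c₁ ≡ oddAnchors c₂
lemma5p10 n@(suc (suc _)) (s≤s (s≤s _)) G _ c₁ c₂ cG₁ conv₁ cG₂ conv₂ = begin
  oddAnchors c₁                                               ≡⟨ oddAnchors≡changesAlong c₁ ⟩
  changesAlong false (λ j → lastTypeUpTo j (entries c₁)) 0 n ≡⟨ changesAlong-cong false 0 n sameLastTypes ⟩
  changesAlong false (λ j → lastTypeUpTo j (entries c₂)) 0 n ≡⟨ sym (oddAnchors≡changesAlong c₂) ⟩
  oddAnchors c₂                                               ∎
  where
  open ≡-Reasoning
  sameLastTypes : ∀ j → 0 ≤ j → lastTypeUpTo j (entries c₁) ≡ lastTypeUpTo j (entries c₂)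
  sameLastTypes zero    _ = vertexOne-type-agrees c₁ c₂ cG₁ cG₂ conv₁ conv₂
  sameLastTypes (suc j) _ = lastTypeUpTo-determined c₁ c₂ cG₁ cG₂ (suc j) (s≤s z≤n)
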